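{- For integers $0\le s\le n$, \[ \operatorname{Cat}_{(2n+1-s,s)}=\sum_{i=0}^s \operatorname{Mot}_{(i+n-s,\,n-s)}\binom{n}{s-i},\qquad \operatorname{Cat}_{(2n-s,s)}=\sum_{i=0}^s \operatorname{Rior}_{(i+n-s,\,n-s)}\binom{n}{s-i}. \]
   Context: Catalan triangle numbers: $\operatorname{Cat}_{(p,k)}=\binom{p+k}{k}-\binom{p+k}{k-1}$ for $0\le k\le p$, and $0$ otherwise. A Motzkin-type path uses steps $U:(i,j)\to(i+1,j+1)$, $H:(i,j)\to(i+1,j)$, $D:(i,j)\to(i+1,j-1)$, starts at $(0,0)$ and stays weakly above the line $y=0$. The Motzkin triangle number $\operatorname{Mot}_{(p,k)}$ is the number of such paths ending at $(p,k)$ (equivalently $\sum_{i=0}^{\lfloor (p-k)/2\rfloor}\binom{p}{2i+k}\bigl[\binom{2i+k}{i}-\binom{2i+k}{i-1}\bigr]$). The Riordan triangle number $\operatorname{Rior}_{(p,k)}$ is the number of such paths ending at $(p,k)$ that have no $H$-step on the line $y=0$. -}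

module Defs where

open import Data.Nat using (ℕ; zero; suc; _+_; _∸_; _≤ᵇ_)
open import Data.Bool using (if_then_else_)
open import Data.Nat.Combinatorics using (_C_)

-- For k ≤ p the difference is nonnegative, so truncated subtraction is exact.
-- The term C(p+k, k-1) is 0 when k = 0.
Cat : ℕ → ℕ → ℕ
Cat p zero    = 1
Cat p (suc k) = if suc k ≤ᵇ p then (p + suc k) C suc k ∸ (p + suc k) C k else 0

-- Motzkin triangle: number of paths with steps U=(1,1), H=(1,0), D=(1,-1)
-- from (0,0), staying weakly above y = 0, ending at (p , k).
-- Counted by recursion on the last step.
Mot : ℕ → ℕ → ℕ
Mot zero    zero    = 1
Mot zero    (suc k) = 0
Mot (suc p) zero    = Mot p zero + Mot p 1
Mot (suc p) (suc k) = Mot p k + Mot p (suc k) + Mot p (suc (suc k))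

-- Riordan triangle: as Mot, but paths have no H-step on the line y = 0.
Rior : ℕ → ℕ → ℕ
Rior zero    zero    = 1
Rior zero    (suc k) = 0
Rior (suc p) zero    = Rior p 1
Rior (suc p) (suc k) = Rior p k + Rior p (suc k) + Rior p (suc (suc k))

sumTo : ℕ → (ℕ → ℕ) → ℕ
sumTo zero    f = f 0
sumTo (suc n) f = sumTo n f + f (suc n)

{-# OPTIONS --safe #-}

-- Let Dyck L h count the paths with steps (1,±1) from (0,0) to (L,h) that stay
-- weakly above y = 0. By Pascal's rule the binomial transform
-- T n f = Σ_j C(n,j) f j satisfies T (n+1) f = T n f + T n (f ∘ suc), and under
-- this recurrence the Motzkin (resp. Riordan) recurrence becomes the two-step
-- recurrence of Dyck paths, so T n (Mot · m) = Dyck (2n+1) (2m+1) and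
-- T n (Rior · m) = Dyck (2n) (2m). The ballot formula
-- Dyck (h+2k) h = C(h+2k,k) - C(h+2k,k-1) identifies Dyck (h+2k) h with Cat (h+k) k.
-- Writing n = s + m, the terms j < m of T n vanish and C(n, i+m) = C(n, s-i).

module Submission where

import Algebra.Properties.CommutativeSemigroup as CommutativeSemigroupProperties
open import Data.Bool using (true)
open import Data.Nat using (ℕ; zero; suc; _+_; _*_; _∸_; _≤_; _<_; _≤ᵇ_; z≤n; s≤s)
open import Data.Nat.Properties
open import Data.Nat.Combinatorics using (_C_; nCk+nC[k+1]≡[n+1]C[k+1]; nCk≡nC[n∸k]; k>n⇒nCk≡0)
open import Data.Nat.Tactic.RingSolver using (solve-∀)
open import Data.Product using (_×_; _,_)
open import Relation.Binary.PropositionalEquality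
  using (_≡_; refl; sym; trans; cong; cong₂; subst; module ≡-Reasoning)

open import Defs

open CommutativeSemigroupProperties +-commutativeSemigroup using (interchange; x∙yz≈y∙xz; x∙yz≈xz∙y)
open ≡-Reasoning

sumTo-cong : ∀ n {f g : ℕ → ℕ} → (∀ j → j ≤ n → f j ≡ g j) → sumTo n f ≡ sumTo n g
sumTo-cong zero    f≗g = f≗g 0 z≤n
sumTo-cong (suc n) f≗g =
  cong₂ _+_ (sumTo-cong n λ j j≤n → f≗g j (m≤n⇒m≤1+n j≤n)) (f≗g (suc n) ≤-refl)

sumTo-+ : ∀ n (f g : ℕ → ℕ) → sumTo n (λ j → f j + g j) ≡ sumTo n f + sumTo n g
sumTo-+ zero    f g = refl
sumTo-+ (suc n) f g =
  trans (cong (_+ (f (suc n) + g (suc n))) (sumTo-+ n f g))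
        (interchange (sumTo n f) (sumTo n g) (f (suc n)) (g (suc n)))

sumTo-head : ∀ n (f : ℕ → ℕ) → sumTo (suc n) f ≡ f 0 + sumTo n (λ j → f (suc j))
sumTo-head zero    f = refl
sumTo-head (suc n) f =
  trans (cong (_+ f (suc (suc n))) (sumTo-head n f))
        (+-assoc (f 0) (sumTo n (λ j → f (suc j))) (f (suc (suc n))))

sumTo-zero : ∀ n (f : ℕ → ℕ) → (∀ j → j ≤ n → f j ≡ 0) → sumTo n f ≡ 0
sumTo-zero n f f≗0 = trans (sumTo-cong n f≗0) (sumTo-const0 n)
  where
  sumTo-const0 : ∀ n → sumTo n (λ _ → 0) ≡ 0
  sumTo-const0 zero    = refl
  sumTo-const0 (suc n) = cong (_+ 0) (sumTo-const0 n)

sumTo-dropInitialZeros : ∀ s m (f : ℕ → ℕ) → (∀ j → j < m → f j ≡ 0) →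
                         sumTo (s + m) f ≡ sumTo s (λ i → f (i + m))
sumTo-dropInitialZeros zero    zero    f f<m≗0 = refl
sumTo-dropInitialZeros zero    (suc m) f f<m≗0 =
  cong (_+ f (suc m)) (sumTo-zero m f λ j j≤m → f<m≗0 j (s≤s j≤m))
sumTo-dropInitialZeros (suc s) m       f f<m≗0 =
  cong (_+ f (suc (s + m))) (sumTo-dropInitialZeros s m f f<m≗0)

binomialTransform : ℕ → (ℕ → ℕ) → ℕ
binomialTransform n f = sumTo n (λ j → (n C j) * f j)

binomialTransform-+ : ∀ n (f g : ℕ → ℕ) →
  binomialTransform n (λ j → f j + g j) ≡ binomialTransform n f + binomialTransform n g
binomialTransform-+ n f g =
  trans (sumTo-cong n λ j _ → *-distribˡ-+ (n C j) (f j) (g j)) (sumTo-+ n _ _)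

binomialTransform-suc : ∀ n (f : ℕ → ℕ) →
  binomialTransform (suc n) f ≡ binomialTransform n f + binomialTransform n (λ j → f (suc j))
binomialTransform-suc n f = begin
  binomialTransform (suc n) f
    ≡⟨ sumTo-head n _ ⟩
  1 * f 0 + sumTo n (λ j → (suc n C suc j) * f (suc j))
    ≡⟨ cong₂ _+_ (*-identityˡ (f 0)) (sumTo-cong n λ j _ → pascal j) ⟩
  f 0 + sumTo n (λ j → (n C j) * f (suc j) + (n C suc j) * f (suc j))
    ≡⟨ cong (f 0 +_) (sumTo-+ n _ _) ⟩
  f 0 + (binomialTransform n (λ j → f (suc j)) + upperTerms)
    ≡⟨ x∙yz≈xz∙y (f 0) (binomialTransform n (λ j → f (suc j))) upperTerms ⟩
  (f 0 + upperTerms) + binomialTransform n (λ j → f (suc j))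
    ≡⟨ cong (_+ binomialTransform n (λ j → f (suc j))) (sym peel) ⟩
  binomialTransform n f + binomialTransform n (λ j → f (suc j))
    ∎
  where
  upperTerms : ℕ
  upperTerms = sumTo n (λ j → (n C suc j) * f (suc j))

  pascal : ∀ j → (suc n C suc j) * f (suc j) ≡ (n C j) * f (suc j) + (n C suc j) * f (suc j)
  pascal j = trans (cong (_* f (suc j)) (sym (nCk+nC[k+1]≡[n+1]C[k+1] n j)))
                   (*-distribʳ-+ (f (suc j)) (n C j) (n C suc j))

  peel : binomialTransform n f ≡ f 0 + upperTerms
  peel = begin
    binomialTransform n f
      ≡⟨ sym (+-identityʳ _) ⟩
    binomialTransform n f + 0 * f (suc n)
      ≡⟨ cong (λ c → binomialTransform n f + c * f (suc n)) (sym (k>n⇒nCk≡0 (n<1+n n))) ⟩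
    sumTo (suc n) (λ j → (n C j) * f j)
      ≡⟨ sumTo-head n _ ⟩
    1 * f 0 + upperTerms
      ≡⟨ cong (_+ upperTerms) (*-identityˡ (f 0)) ⟩
    f 0 + upperTerms
      ∎

double : ℕ → ℕ
double zero    = zero
double (suc n) = suc (suc (double n))

double≡n+n : ∀ n → double n ≡ n + n
double≡n+n zero    = refl
double≡n+n (suc n) = cong suc (trans (cong suc (double≡n+n n)) (sym (+-suc n n)))

double-+ : ∀ m n → double (m + n) ≡ double m + double n
double-+ zero    n = refl
double-+ (suc m) n = cong (λ d → suc (suc d)) (double-+ m n)

double-+-comm : ∀ m n → double m + double n ≡ double (n + m)
double-+-comm m n = trans (sym (double-+ m n)) (cong double (+-comm m n))

Dyck : ℕ → ℕ → ℕ
Dyck zero    zero    = 1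
Dyck zero    (suc h) = 0
Dyck (suc L) zero    = Dyck L 1
Dyck (suc L) (suc h) = Dyck L h + Dyck L (suc (suc h))

Dyck-vanish : ∀ {L h} → L < h → Dyck L h ≡ 0
Dyck-vanish {zero}  {suc h} _         = refl
Dyck-vanish {suc L} {suc h} (s≤s L<h) =
  cong₂ _+_ (Dyck-vanish L<h) (Dyck-vanish (m<n⇒m<1+n (m<n⇒m<1+n L<h)))

Dyck-diag : ∀ L → Dyck L L ≡ 1
Dyck-diag zero    = refl
Dyck-diag (suc L) = cong₂ _+_ (Dyck-diag L) (Dyck-vanish (m<n⇒m<1+n (n<1+n L)))

Dyck-suc²-suc² : ∀ L h → Dyck (suc (suc L)) (suc (suc h)) ≡
  Dyck L (suc (suc h)) + (Dyck L h + Dyck L (suc (suc h)) + Dyck L (suc (suc (suc (suc h)))))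
Dyck-suc²-suc² L h =
  sym (x∙yz≈y∙xz (Dyck L (suc (suc h)))
                  (Dyck L h + Dyck L (suc (suc h)))
                  (Dyck L (suc (suc (suc (suc h))))))

Mot-vanish : ∀ {p k} → p < k → Mot p k ≡ 0
Mot-vanish {zero}  {suc k} _         = refl
Mot-vanish {suc p} {suc k} (s≤s p<k) =
  cong₂ _+_ (cong₂ _+_ (Mot-vanish p<k) (Mot-vanish (m<n⇒m<1+n p<k)))
            (Mot-vanish (m<n⇒m<1+n (m<n⇒m<1+n p<k)))

Rior-vanish : ∀ {p k} → p < k → Rior p k ≡ 0
Rior-vanish {zero}  {suc k} _         = refl
Rior-vanish {suc p} {suc k} (s≤s p<k) =
  cong₂ _+_ (cong₂ _+_ (Rior-vanish p<k) (Rior-vanish (m<n⇒m<1+n p<k)))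
            (Rior-vanish (m<n⇒m<1+n (m<n⇒m<1+n p<k)))

binomialTransform-Mot : ∀ n m →
  binomialTransform n (λ j → Mot j m) ≡ Dyck (suc (double n)) (suc (double m))
binomialTransform-Mot zero    zero    = refl
binomialTransform-Mot zero    (suc m) = refl
binomialTransform-Mot (suc n) zero
  rewrite binomialTransform-suc n (λ j → Mot j 0)
        | binomialTransform-+ n (λ j → Mot j 0) (λ j → Mot j 1)
        | binomialTransform-Mot n 0 | binomialTransform-Mot n 1 = refl
binomialTransform-Mot (suc n) (suc m)
  rewrite binomialTransform-suc n (λ j → Mot j (suc m))
        | binomialTransform-+ n (λ j → Mot j m + Mot j (suc m)) (λ j → Mot j (suc (suc m)))
        | binomialTransform-+ n (λ j → Mot j m) (λ j → Mot j (suc m))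
        | binomialTransform-Mot n m
        | binomialTransform-Mot n (suc m)
        | binomialTransform-Mot n (suc (suc m)) = sym (Dyck-suc²-suc² (suc (double n)) (suc (double m)))

binomialTransform-Rior : ∀ n m →
  binomialTransform n (λ j → Rior j m) ≡ Dyck (double n) (double m)
binomialTransform-Rior zero    zero    = refl
binomialTransform-Rior zero    (suc m) = refl
binomialTransform-Rior (suc n) zero
  rewrite binomialTransform-suc n (λ j → Rior j 0)
        | binomialTransform-Rior n 0 | binomialTransform-Rior n 1 = refl
binomialTransform-Rior (suc n) (suc m)
  rewrite binomialTransform-suc n (λ j → Rior j (suc m))
        | binomialTransform-+ n (λ j → Rior j m + Rior j (suc m)) (λ j → Rior j (suc (suc m)))
        | binomialTransform-+ n (λ j → Rior j m) (λ j → Rior j (suc m))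
        | binomialTransform-Rior n m
        | binomialTransform-Rior n (suc m)
        | binomialTransform-Rior n (suc (suc m)) = sym (Dyck-suc²-suc² (double n) (double m))

-- n C (k - 1), with the k = 0 case set to 0 instead of the truncated n C 0.
_C₋₁_ : ℕ → ℕ → ℕ
n C₋₁ zero  = 0
n C₋₁ suc k = n C k

[1+n]Ck≡nCk+nC₋₁k : ∀ n k → suc n C k ≡ n C k + n C₋₁ k
[1+n]Ck≡nCk+nC₋₁k n zero    = refl
[1+n]Ck≡nCk+nC₋₁k n (suc k) =
  trans (sym (nCk+nC[k+1]≡[n+1]C[k+1] n k)) (+-comm (n C k) (n C suc k))

[1+2k]C[1+k]≡[1+2k]Ck : ∀ k → suc (double k) C suc k ≡ suc (double k) C k
[1+2k]C[1+k]≡[1+2k]Ck k =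
  trans (nCk≡nC[n∸k] (s≤s k≤2k)) (cong (suc (double k) C_) 2k∸k≡k)
  where
  k≤2k : k ≤ double k
  k≤2k = subst (k ≤_) (sym (double≡n+n k)) (m≤m+n k k)
  2k∸k≡k : double k ∸ k ≡ k
  2k∸k≡k = trans (cong (_∸ k) (double≡n+n k)) (m+n∸n≡m k k)

Dyck-ballot : ∀ k h → Dyck (h + double k) h + (h + double k) C₋₁ k ≡ (h + double k) C k
Dyck-ballot zero    h rewrite +-identityʳ h | +-identityʳ (Dyck h h) = Dyck-diag h
Dyck-ballot (suc k) zero = begin
  Dyck Q 1 + suc Q C k              ≡⟨ cong (Dyck Q 1 +_) ([1+n]Ck≡nCk+nC₋₁k Q k) ⟩
  Dyck Q 1 + (Q C k + Q C₋₁ k)      ≡⟨ x∙yz≈xz∙y (Dyck Q 1) (Q C k) (Q C₋₁ k) ⟩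
  (Dyck Q 1 + Q C₋₁ k) + Q C k      ≡⟨ cong (_+ Q C k) (Dyck-ballot k 1) ⟩
  Q C k + Q C k                     ≡⟨ cong (Q C k +_) (sym ([1+2k]C[1+k]≡[1+2k]Ck k)) ⟩
  Q C k + Q C suc k                 ≡⟨ nCk+nC[k+1]≡[n+1]C[k+1] Q k ⟩
  suc Q C suc k                     ∎
  where
  Q : ℕ
  Q = suc (double k)
Dyck-ballot (suc k) (suc h) = begin
  Dyck P h + Dyck P h+2 + suc P C k
    ≡⟨ cong (Dyck P h + Dyck P h+2 +_) ([1+n]Ck≡nCk+nC₋₁k P k) ⟩
  Dyck P h + Dyck P h+2 + (P C k + P C₋₁ k)
    ≡⟨ interchange (Dyck P h) (Dyck P h+2) (P C k) (P C₋₁ k) ⟩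
  (Dyck P h + P C k) + (Dyck P h+2 + P C₋₁ k)
    ≡⟨ cong₂ _+_ (Dyck-ballot (suc k) h) ballot-k ⟩
  P C suc k + P C k
    ≡⟨ sym ([1+n]Ck≡nCk+nC₋₁k P (suc k)) ⟩
  suc P C suc k
    ∎
  where
  P h+2 : ℕ
  P = h + suc (suc (double k))
  h+2 = suc (suc h)

  ballot-k : Dyck P h+2 + P C₋₁ k ≡ P C k
  ballot-k = subst (λ L → Dyck L h+2 + L C₋₁ k ≡ L C k)
                   (sym (trans (+-suc h (suc (double k))) (cong suc (+-suc h (double k)))))
                   (Dyck-ballot k h+2)

Cat-suc : ∀ {p k} → suc k ≤ p → Cat p (suc k) ≡ (p + suc k) C suc k ∸ (p + suc k) C k
Cat-suc {p} {k} k<p with suc k ≤ᵇ p | ≤⇒≤ᵇ k<p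
... | true | _ = refl

Cat≡Dyck : ∀ k h → Cat (h + k) k ≡ Dyck (h + double k) h
Cat≡Dyck zero    h rewrite +-identityʳ h = sym (Dyck-diag h)
Cat≡Dyck (suc k) h = begin
  Cat (h + suc k) (suc k)                           ≡⟨ Cat-suc (m≤n+m (suc k) h) ⟩
  (h + suc k + suc k) C suc k ∸ (h + suc k + suc k) C k
                                                    ≡⟨ cong (λ N → N C suc k ∸ N C k) length ⟩
  L C suc k ∸ L C k                                 ≡⟨ cong (_∸ L C k) (sym (Dyck-ballot (suc k) h)) ⟩
  Dyck L h + L C k ∸ L C k                          ≡⟨ m+n∸n≡m (Dyck L h) (L C k) ⟩
  Dyck L h                                          ∎
  where
  L : ℕ
  L = h + double (suc k)

  length : h + suc k + suc k ≡ L
  length = trans (+-assoc h (suc k) (suc k)) (cong (h +_) (sym (double≡n+n (suc k))))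

[s+m]C[i+m]≡[s+m]C[s∸i] : ∀ {s i} m → i ≤ s → (s + m) C (i + m) ≡ (s + m) C (s ∸ i)
[s+m]C[i+m]≡[s+m]C[s∸i] {s} {i} m i≤s = begin
  (s + m) C (i + m)                ≡⟨ nCk≡nC[n∸k] (+-monoˡ-≤ m i≤s) ⟩
  (s + m) C ((s + m) ∸ (i + m))    ≡⟨ cong (λ k → (s + m) C k) ∸-cancelʳ ⟩
  (s + m) C (s ∸ i)                ∎
  where
  ∸-cancelʳ : (s + m) ∸ (i + m) ≡ s ∸ i
  ∸-cancelʳ = trans (cong₂ _∸_ (+-comm s m) (+-comm i m)) ([m+n]∸[m+o]≡n∸o m s i)

binomialTransform-reindex : ∀ s m (f : ℕ → ℕ) → (∀ j → j < m → f j ≡ 0) →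
  binomialTransform (s + m) f ≡ sumTo s (λ i → f (i + m) * ((s + m) C (s ∸ i)))
binomialTransform-reindex s m f f<m≗0 = begin
  binomialTransform (s + m) f
    ≡⟨ sumTo-dropInitialZeros s m _ initialTerms≡0 ⟩
  sumTo s (λ i → ((s + m) C (i + m)) * f (i + m))
    ≡⟨ sumTo-cong s reflectTerm ⟩
  sumTo s (λ i → f (i + m) * ((s + m) C (s ∸ i)))
    ∎
  where
  initialTerms≡0 : ∀ j → j < m → ((s + m) C j) * f j ≡ 0
  initialTerms≡0 j j<m = trans (cong (((s + m) C j) *_) (f<m≗0 j j<m)) (*-zeroʳ ((s + m) C j))

  reflectTerm : ∀ i → i ≤ s → ((s + m) C (i + m)) * f (i + m) ≡ f (i + m) * ((s + m) C (s ∸ i))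
  reflectTerm i i≤s =
    trans (*-comm _ (f (i + m))) (cong (f (i + m) *_) ([s+m]C[i+m]≡[s+m]C[s∸i] m i≤s))

Cat≡sumMot : ∀ s m →
  Cat (suc (double m) + s) s ≡ sumTo s (λ i → Mot (i + m) m * ((s + m) C (s ∸ i)))
Cat≡sumMot s m = begin
  Cat (suc (double m) + s) s
    ≡⟨ Cat≡Dyck s (suc (double m)) ⟩
  Dyck (suc (double m + double s)) (suc (double m))
    ≡⟨ cong (λ L → Dyck (suc L) (suc (double m))) (double-+-comm m s) ⟩
  Dyck (suc (double (s + m))) (suc (double m))
    ≡⟨ sym (binomialTransform-Mot (s + m) m) ⟩
  binomialTransform (s + m) (λ j → Mot j m)
    ≡⟨ binomialTransform-reindex s m _ (λ _ → Mot-vanish) ⟩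
  sumTo s (λ i → Mot (i + m) m * ((s + m) C (s ∸ i)))
    ∎

Cat≡sumRior : ∀ s m →
  Cat (double m + s) s ≡ sumTo s (λ i → Rior (i + m) m * ((s + m) C (s ∸ i)))
Cat≡sumRior s m = begin
  Cat (double m + s) s
    ≡⟨ Cat≡Dyck s (double m) ⟩
  Dyck (double m + double s) (double m)
    ≡⟨ cong (λ L → Dyck L (double m)) (double-+-comm m s) ⟩
  Dyck (double (s + m)) (double m)
    ≡⟨ sym (binomialTransform-Rior (s + m) m) ⟩
  binomialTransform (s + m) (λ j → Rior j m)
    ≡⟨ binomialTransform-reindex s m _ (λ _ → Rior-vanish) ⟩
  sumTo s (λ i → Rior (i + m) m * ((s + m) C (s ∸ i)))
    ∎

2*[s+m]≡double[m]+s+s : ∀ s m → 2 * (s + m) ≡ double m + s + s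
2*[s+m]≡double[m]+s+s s m = trans (semiring s m) (cong (λ d → d + s + s) (sym (double≡n+n m)))
  where
  semiring : ∀ s m → 2 * (s + m) ≡ m + m + s + s
  semiring = solve-∀

proposition5p15 : (n s : ℕ) → s ≤ n →
    (Cat (2 * n + 1 ∸ s) s ≡ sumTo s (λ i → Mot (i + (n ∸ s)) (n ∸ s) * (n C (s ∸ i))))
    × (Cat (2 * n ∸ s) s ≡ sumTo s (λ i → Rior (i + (n ∸ s)) (n ∸ s) * (n C (s ∸ i))))
proposition5p15 n s s≤n with m , refl ← m≤n⇒∃[o]m+o≡n s≤n rewrite m+n∸m≡n s m =
    trans (cong (λ p → Cat p s) odd) (Cat≡sumMot s m)
  , trans (cong (λ p → Cat p s) even) (Cat≡sumRior s m)
  where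
  even : 2 * (s + m) ∸ s ≡ double m + s
  even = trans (cong (_∸ s) (2*[s+m]≡double[m]+s+s s m)) (m+n∸n≡m (double m + s) s)
  odd : 2 * (s + m) + 1 ∸ s ≡ suc (double m) + s
  odd = trans (cong (λ p → p + 1 ∸ s) (2*[s+m]≡double[m]+s+s s m))
              (trans (cong (_∸ s) (+-comm (double m + s + s) 1)) (m+n∸n≡m (suc (double m) + s) s))
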